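{- Fix $n\geq1$. Let $\mathsf{F}$ be the group (under matrix multiplication) of all $n\times n$ matrices $P_{\lambda_w,\mu}^{[0,v,w]}$ with $v,w\in\mathbb{C}$, $v\neq0$, and let $\mathrm{WRM}(n)$ be the set of all $n\times n$ matrices $P_{\alpha,\beta}^{[x,y,z]}$, where $x,y,z\in\mathbb{C}$ and $\alpha,\beta$ range over complex sequences with $\alpha_0=\beta_0$. Then $\mathsf{F}$ acts on $\mathrm{WRM}(n)$ by left multiplication: for every $A\in\mathsf{F}$ and $M\in\mathrm{WRM}(n)$ one has $AM\in\mathrm{WRM}(n)$, and the rule $M^{A}:=A^{ -1}M$ defines a (right) group action of $\mathsf{F}$ on $\mathrm{WRM}(n)$, i.e. $M^{I}=M$ and $M^{AB}=(M^{A})^{B}$ for all $A,B\in\mathsf{F}$, $M\in\mathrm{WRM}(n)$.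
   Context: For complex numbers $x,y,z$ and complex sequences $\alpha=(\alpha_i)_{i\geq0}$, $\beta=(\beta_i)_{i\geq0}$ with $\alpha_0=\beta_0$, the weighted recurrence matrix $P_{\alpha,\beta}^{[x,y,z]}=[P_{i,j}]_{i,j\geq0}$ is the infinite matrix defined by $P_{i,0}=\alpha_i$, $P_{0,j}=\beta_j$ for $i,j\geq 0$, and $P_{i,j}=xP_{i,j-1}+yP_{i-1,j-1}+zP_{i-1,j}$ for $i,j\geq1$. For $z\in\mathbb{C}$, $\lambda_z=(z^i)_{i\geq0}$ (with the convention $0^0=1$), and $\mu=(1,0,0,\ldots)$; thus $P_{\lambda_w,\mu}^{[0,v,w]}$ is the lower triangular matrix with entries $\binom{i}{j}v^jw^{i-j}$. An $n\times n$ matrix $P_{\alpha,\beta}^{[x,y,z]}$ means the principal $n\times n$ submatrix (rows and columns $0,\ldots,n-1$) of the infinite matrix. -}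

module Defs where

open import Level using (Level; _⊔_)
open import Data.Nat using (ℕ; zero; suc)
open import Data.Fin using (Fin; toℕ)
open import Data.Product using (Σ; _×_; _,_; ∃)
open import Relation.Nullary using (¬_; yes; no)
import Data.Fin as Fin
open import Data.Fin using () renaming (_≟_ to _≟F_)
open import Algebra.Bundles using (CommutativeRing)

IsField : ∀ {c ℓ} → CommutativeRing c ℓ → Set (c ⊔ ℓ)
IsField R = ¬ (0# ≈ 1#) × (∀ a → ¬ (a ≈ 0#) → Σ Carrier λ b → a * b ≈ 1#)
  where open CommutativeRing R

module WRM {c ℓ} (R : CommutativeRing c ℓ) where
  open CommutativeRing R

  Seq : Set c
  Seq = ℕ → Carrier

  -- the infinite weighted recurrence matrix P^{[x,y,z]}_{α,β}
  -- P i 0 = α i, P 0 j = β j (j ≥ 1; for j = 0 the standing hypothesis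
  -- α 0 = β 0 makes the choice irrelevant),
  -- P (i+1) (j+1) = x P (i+1) j + y P i j + z P i (j+1).
  P : Seq → Seq → Carrier → Carrier → Carrier → ℕ → ℕ → Carrier
  P α β x y z i       zero    = α i
  P α β x y z zero    (suc j) = β (suc j)
  P α β x y z (suc i) (suc j) =
    x * P α β x y z (suc i) j + y * P α β x y z i j + z * P α β x y z i (suc j)

  pow : Carrier → ℕ → Carrier
  pow w zero    = 1#
  pow w (suc i) = w * pow w i

  lam : Carrier → Seq
  lam w i = pow w i

  mu : Seq
  mu zero    = 1#
  mu (suc _) = 0#

  Mat : ℕ → Set c
  Mat n = Fin n → Fin n → Carrier

  _≈M_ : ∀ {n} → Mat n → Mat n → Set ℓ
  A ≈M B = ∀ i j → A i j ≈ B i j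

  trunc : ∀ n → (ℕ → ℕ → Carrier) → Mat n
  trunc n M i j = M (toℕ i) (toℕ j)

  sumFin : ∀ n → (Fin n → Carrier) → Carrier
  sumFin zero    f = 0#
  sumFin (suc n) f = f Fin.zero + sumFin n (λ k → f (Fin.suc k))

  _·_ : ∀ {n} → Mat n → Mat n → Mat n
  _·_ {n} A B i j = sumFin n (λ k → A i k * B k j)

  I : ∀ n → Mat n
  I n i j with i ≟F j
  ... | yes _ = 1#
  ... | no _  = 0#

  InF : ∀ n → Mat n → Set (c ⊔ ℓ)
  InF n A = Σ Carrier λ v → Σ Carrier λ w →
              ¬ (v ≈ 0#) × (A ≈M trunc n (P (lam w) mu 0# v w))

  InWRM : ∀ n → Mat n → Set (c ⊔ ℓ)
  InWRM n M = Σ Carrier λ x → Σ Carrier λ y → Σ Carrier λ z →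
              Σ Seq λ α → Σ Seq λ β →
                (α 0 ≈ β 0) × (M ≈M trunc n (P α β x y z))

  IsInverse : ∀ {n} → Mat n → Mat n → Set ℓ
  IsInverse {n} A B = ((A · B) ≈M I n) × ((B · A) ≈M I n)

{-# OPTIONS --safe #-}
-- Write F(v,w) = pascal v w for the lower triangular matrix P^{[0,v,w]}_{λ_w,μ}. Its entries
-- satisfy F(i+1,0) = w F(i,0) and F(i+1,k+1) = v F(i,k) + w F(i,k+1), so for any matrix M the
-- product Q = F(v,w) M satisfies Q(i+1,j) = v S(i,j) + w Q(i,j), where S = F(v,w) M⁺ and M⁺
-- is M with its first row removed. If M obeys the recurrence with weights (x,y,z), then by
-- linearity S(i,j+1) = x S(i,j) + y Q(i,j) + z Q(i,j+1), and eliminating S shows that Q obeys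
-- the recurrence with weights (x, vy − xw, w + vz). Since F(v,w) is lower triangular, none of
-- this is disturbed by truncating to n × n. Taking M = F(v′,w′) gives
-- F(v,w) F(v′,w′) = F(vv′, w + vw′), so F is a group with F(v,w)⁻¹ = F(v⁻¹, −wv⁻¹). The action
-- laws are then the facts that inverses in the matrix monoid are unique and (AB)⁻¹ = B⁻¹A⁻¹.
module Submission where

open import Defs
open import Data.Nat using (ℕ; _≥_; zero; suc; _<_; s≤s)
open import Data.Product using (Σ; _×_; _,_; proj₁; proj₂)
open import Algebra.Bundles using (CommutativeRing)
open import Data.Nat.Properties using (<⇒≤)
open import Data.Fin using (Fin; toℕ)
import Data.Fin as Fin
open import Data.Fin using () renaming (_≟_ to _≟F_)
open import Data.Fin.Properties using (toℕ<n)
open import Function using (_∘_)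
open import Relation.Binary.Bundles using (Setoid)
open import Relation.Nullary using (¬_; yes; no)
open import Relation.Binary.PropositionalEquality as ≡ using (_≡_)

module Matrices {c ℓ} (K : CommutativeRing c ℓ) where
  open CommutativeRing K
  open WRM K
  open import Algebra.Properties.Semiring.Sum semiring
  open import Relation.Binary.Reasoning.Setoid setoid

  sumFin≡sum : ∀ n (f : Fin n → Carrier) → sumFin n f ≡ sum f
  sumFin≡sum zero    f = ≡.refl
  sumFin≡sum (suc n) f = ≡.cong (f Fin.zero +_) (sumFin≡sum n (f ∘ Fin.suc))

  ·-entry : ∀ {n} (A B : Mat n) i j → (A · B) i j ≡ ∑[ k < n ] (A i k * B k j)
  ·-entry {n} A B i j = sumFin≡sum n (λ k → A i k * B k j)

  Mat-setoid : ℕ → Setoid c ℓ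
  Mat-setoid n = record
    { Carrier       = Mat n
    ; _≈_           = _≈M_
    ; isEquivalence = record
      { refl  = λ i j → refl
      ; sym   = λ A≈B i j → sym (A≈B i j)
      ; trans = λ A≈B B≈C i j → trans (A≈B i j) (B≈C i j)
      }
    }

  open module MatSetoid {n} = Setoid (Mat-setoid n) public
    using () renaming (refl to ≈M-refl; trans to ≈M-trans)

  ·-cong : ∀ {n} {A A′ B B′ : Mat n} → A ≈M A′ → B ≈M B′ → (A · B) ≈M (A′ · B′)
  ·-cong {n} {A} {A′} {B} {B′} A≈A′ B≈B′ i j = begin
    (A · B) i j                   ≡⟨ ·-entry A B i j ⟩
    ∑[ k < n ] (A i k * B k j)    ≈⟨ sum-cong-≋ (λ k → *-cong (A≈A′ i k) (B≈B′ k j)) ⟩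
    ∑[ k < n ] (A′ i k * B′ k j)  ≡⟨ ·-entry A′ B′ i j ⟨
    (A′ · B′) i j                 ∎

  ·-assoc : ∀ {n} (A B C : Mat n) → ((A · B) · C) ≈M (A · (B · C))
  ·-assoc {n} A B C i j = begin
    ((A · B) · C) i j
      ≡⟨ ·-entry (A · B) C i j ⟩
    ∑[ l < n ] ((A · B) i l * C l j)
      ≈⟨ sum-cong-≋ (λ l → *-congʳ (reflexive (·-entry A B i l))) ⟩
    ∑[ l < n ] (∑[ k < n ] (A i k * B k l) * C l j)
      ≈⟨ sum-cong-≋ pull-in ⟩
    ∑[ l < n ] ∑[ k < n ] t k l
      ≈⟨ ∑-comm (λ l k → t k l) ⟩
    ∑[ k < n ] ∑[ l < n ] t k l
      ≈⟨ sum-cong-≋ (λ k → *-distribˡ-sum (A i k) (λ l → B k l * C l j)) ⟨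
    ∑[ k < n ] (A i k * ∑[ l < n ] (B k l * C l j))
      ≈⟨ sum-cong-≋ (λ k → *-congˡ (reflexive (·-entry B C k j))) ⟨
    ∑[ k < n ] (A i k * (B · C) k j)
      ≡⟨ ·-entry A (B · C) i j ⟨
    (A · (B · C)) i j
      ∎
    where
    t : Fin n → Fin n → Carrier
    t k l = A i k * (B k l * C l j)
    pull-in : ∀ l → ∑[ k < n ] (A i k * B k l) * C l j ≈ ∑[ k < n ] t k l
    pull-in l = trans (*-distribʳ-sum (C l j) (λ k → A i k * B k l))
                      (sum-cong-≋ (λ k → *-assoc (A i k) (B k l) (C l j)))

  I-suc : ∀ {n} (i j : Fin n) → I (suc n) (Fin.suc i) (Fin.suc j) ≡ I n i j
  I-suc i j with i ≟F j
  ... | yes _ = ≡.refl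
  ... | no _  = ≡.refl

  ∑-0#* : ∀ n (f : Fin n → Carrier) → ∑[ k < n ] (0# * f k) ≈ 0#
  ∑-0#* n f = trans (sum-cong-≋ (λ k → zeroˡ (f k))) (sum-replicate-zero n)

  ∑-*0# : ∀ n (f : Fin n → Carrier) → ∑[ k < n ] (f k * 0#) ≈ 0#
  ∑-*0# n f = trans (sum-cong-≋ (λ k → zeroʳ (f k))) (sum-replicate-zero n)

  ∑-Iˡ : ∀ {n} (i : Fin n) (f : Fin n → Carrier) → ∑[ k < n ] (I n i k * f k) ≈ f i
  ∑-Iˡ {suc n} Fin.zero f =
    trans (+-cong (*-identityˡ _) (∑-0#* n (f ∘ Fin.suc))) (+-identityʳ _)
  ∑-Iˡ {suc n} (Fin.suc i) f = begin
    0# * f Fin.zero + ∑[ k < n ] (I (suc n) (Fin.suc i) (Fin.suc k) * f (Fin.suc k))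
      ≈⟨ +-cong (zeroˡ _) (sum-cong-≋ (λ k → *-congʳ (reflexive (I-suc i k)))) ⟩
    0# + ∑[ k < n ] (I n i k * f (Fin.suc k))  ≈⟨ +-identityˡ _ ⟩
    ∑[ k < n ] (I n i k * f (Fin.suc k))       ≈⟨ ∑-Iˡ i (f ∘ Fin.suc) ⟩
    f (Fin.suc i)                              ∎

  ∑-Iʳ : ∀ {n} (j : Fin n) (f : Fin n → Carrier) → ∑[ k < n ] (f k * I n k j) ≈ f j
  ∑-Iʳ {suc n} Fin.zero f =
    trans (+-cong (*-identityʳ _) (∑-*0# n (f ∘ Fin.suc))) (+-identityʳ _)
  ∑-Iʳ {suc n} (Fin.suc j) f = begin
    f Fin.zero * 0# + ∑[ k < n ] (f (Fin.suc k) * I (suc n) (Fin.suc k) (Fin.suc j))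
      ≈⟨ +-cong (zeroʳ _) (sum-cong-≋ (λ k → *-congˡ (reflexive (I-suc k j)))) ⟩
    0# + ∑[ k < n ] (f (Fin.suc k) * I n k j)  ≈⟨ +-identityˡ _ ⟩
    ∑[ k < n ] (f (Fin.suc k) * I n k j)       ≈⟨ ∑-Iʳ j (f ∘ Fin.suc) ⟩
    f (Fin.suc j)                              ∎

  ·-identityˡ : ∀ {n} (A : Mat n) → (I n · A) ≈M A
  ·-identityˡ {n} A i j = trans (reflexive (·-entry (I n) A i j)) (∑-Iˡ i (λ k → A k j))

  ·-identityʳ : ∀ {n} (A : Mat n) → (A · I n) ≈M A
  ·-identityʳ {n} A i j = trans (reflexive (·-entry A (I n) i j)) (∑-Iʳ j (A i))

module Inverses {c ℓ} (K : CommutativeRing c ℓ) where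
  open WRM K
  open Matrices K

  module _ {n : ℕ} where
    open Setoid (Mat-setoid n) using (refl)
    open import Relation.Binary.Reasoning.Setoid (Mat-setoid n)

    inverse-unique : ∀ {L A R : Mat n} → (L · A) ≈M I n → (A · R) ≈M I n → L ≈M R
    inverse-unique {L} {A} {R} LA≈I AR≈I = begin
      L            ≈⟨ ·-identityʳ L ⟨
      L · I n      ≈⟨ ·-cong refl AR≈I ⟨
      L · (A · R)  ≈⟨ ·-assoc L A R ⟨
      (L · A) · R  ≈⟨ ·-cong LA≈I refl ⟩
      I n · R      ≈⟨ ·-identityˡ R ⟩
      R            ∎

    inverse-of-I : ∀ {J : Mat n} → IsInverse (I n) J → J ≈M I n
    inverse-of-I {J} (IJ≈I , _) = begin
      J        ≈⟨ ·-identityˡ J ⟨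
      I n · J  ≈⟨ IJ≈I ⟩
      I n      ∎

    inverse-of-· : ∀ {A B A′ B′ C′ : Mat n} → IsInverse A A′ → IsInverse B B′ →
                   IsInverse (A · B) C′ → C′ ≈M (B′ · A′)
    inverse-of-· {A} {B} {A′} {B′} (AA′≈I , _) (BB′≈I , _) (_ , C′AB≈I) =
      inverse-unique C′AB≈I (begin
        (A · B) · (B′ · A′)  ≈⟨ ·-assoc A B (B′ · A′) ⟩
        A · (B · (B′ · A′))  ≈⟨ ·-cong refl (·-assoc B B′ A′) ⟨
        A · ((B · B′) · A′)  ≈⟨ ·-cong refl (·-cong BB′≈I refl) ⟩
        A · (I n · A′)       ≈⟨ ·-cong refl (·-identityˡ A′) ⟩
        A · A′               ≈⟨ AA′≈I ⟩
        I n                  ∎)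

    right-action-identity : ∀ {J : Mat n} → IsInverse (I n) J → ∀ M → (J · M) ≈M M
    right-action-identity {J} I⁻¹ M = begin
      J · M    ≈⟨ ·-cong (inverse-of-I I⁻¹) refl ⟩
      I n · M  ≈⟨ ·-identityˡ M ⟩
      M        ∎

    right-action-compose : ∀ {A B A′ B′ C′ : Mat n} → IsInverse A A′ → IsInverse B B′ →
                           IsInverse (A · B) C′ → ∀ M → (C′ · M) ≈M (B′ · (A′ · M))
    right-action-compose {A′ = A′} {B′} {C′} A⁻¹ B⁻¹ AB⁻¹ M = begin
      C′ · M         ≈⟨ ·-cong (inverse-of-· A⁻¹ B⁻¹ AB⁻¹) refl ⟩
      (B′ · A′) · M  ≈⟨ ·-assoc B′ A′ M ⟩
      B′ · (A′ · M)  ∎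

module WeightedRecurrence {c ℓ} (K : CommutativeRing c ℓ) where
  open CommutativeRing K
  open WRM K
  open Matrices K using (·-entry; ≈M-trans; ·-cong; I-suc; ∑-0#*)
  open import Algebra.Properties.Semiring.Sum semiring
  open import Algebra.Properties.CommutativeSemigroup *-commutativeSemigroup using (x∙yz≈y∙xz)
  open import Algebra.Properties.Group +-group using (ε⁻¹≈ε)
  open import Algebra.Solver.Ring.NaturalCoefficients.Default commutativeSemiring
  open import Relation.Binary.Reasoning.Setoid setoid

  RecurrenceAt : Carrier → Carrier → Carrier → (ℕ → ℕ → Carrier) → ℕ → ℕ → Set ℓ
  RecurrenceAt x y z q i j = q (suc i) (suc j) ≈ x * q (suc i) j + y * q i j + z * q i (suc j)

  RecurrenceOn : ℕ → Carrier → Carrier → Carrier → (ℕ → ℕ → Carrier) → Set ℓ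
  RecurrenceOn n x y z q = ∀ i j → suc i < n → suc j < n → RecurrenceAt x y z q i j

  P-unique : ∀ {n q α β x y z} →
    (∀ i → i < n → q i 0 ≈ α i) → (∀ j → j < n → q 0 j ≈ β j) → RecurrenceOn n x y z q →
    trunc n q ≈M trunc n (P α β x y z)
  P-unique {n} {q} {α} {β} {x} {y} {z} column row recurrence i j =
    entry (toℕ i) (toℕ j) (toℕ<n i) (toℕ<n j)
    where
    entry : ∀ i j → i < n → j < n → q i j ≈ P α β x y z i j
    entry i       zero    i<n _   = column i i<n
    entry zero    (suc j) _   j<n = row (suc j) j<n
    entry (suc i) (suc j) i<n j<n = trans (recurrence i j i<n j<n)
      (+-cong (+-cong (*-congˡ (entry (suc i) j i<n (<⇒≤ j<n)))
                      (*-congˡ (entry i j (<⇒≤ i<n) (<⇒≤ j<n))))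
              (*-congˡ (entry i (suc j) (<⇒≤ i<n) j<n)))

  InWRM-resp : ∀ {n M M′} → M ≈M M′ → InWRM n M′ → InWRM n M
  InWRM-resp M≈M′ (x , y , z , α , β , α₀≈β₀ , M′≈P) =
    x , y , z , α , β , α₀≈β₀ , ≈M-trans M≈M′ M′≈P

  InWRM-trunc : ∀ {n x y z q} → RecurrenceOn n x y z q → InWRM n (trunc n q)
  InWRM-trunc {x = x} {y} {z} {q} recurrence =
    x , y , z , (λ i → q i 0) , (λ j → q 0 j) , refl ,
    P-unique (λ _ _ → refl) (λ _ _ → refl) recurrence

  pow-cong : ∀ {w w′} → w ≈ w′ → ∀ i → pow w i ≈ pow w′ i
  pow-cong w≈w′ zero    = refl
  pow-cong w≈w′ (suc i) = *-cong w≈w′ (pow-cong w≈w′ i)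

  pascal : Carrier → Carrier → ℕ → ℕ → Carrier
  pascal v w = P (lam w) mu 0# v w

  pascal-cong : ∀ {v v′ w w′} → v ≈ v′ → w ≈ w′ → ∀ i j → pascal v w i j ≈ pascal v′ w′ i j
  pascal-cong v≈v′ w≈w′ i       zero    = pow-cong w≈w′ i
  pascal-cong v≈v′ w≈w′ zero    (suc j) = refl
  pascal-cong v≈v′ w≈w′ (suc i) (suc j) =
    +-cong (+-cong (*-congˡ (pascal-cong v≈v′ w≈w′ (suc i) j))
                   (*-cong v≈v′ (pascal-cong v≈v′ w≈w′ i j)))
           (*-cong w≈w′ (pascal-cong v≈v′ w≈w′ i (suc j)))

  pascal-zero : ∀ v w j → pascal v w 0 j ≡ mu j
  pascal-zero v w zero    = ≡.refl
  pascal-zero v w (suc j) = ≡.refl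

  pascal-suc-suc : ∀ v w i j →
    pascal v w (suc i) (suc j) ≈ v * pascal v w i j + w * pascal v w i (suc j)
  pascal-suc-suc v w i j = +-congʳ (trans (+-congʳ (zeroˡ _)) (+-identityˡ _))

  pascal-above-diagonal : ∀ v w {i k} → i < k → pascal v w i k ≈ 0#
  pascal-above-diagonal v w {zero}  {suc k} _         = refl
  pascal-above-diagonal v w {suc i} {suc k} (s≤s i<k) = begin
    pascal v w (suc i) (suc k)                     ≈⟨ pascal-suc-suc v w i k ⟩
    v * pascal v w i k + w * pascal v w i (suc k)  ≈⟨ +-cong (*-congˡ (pascal-above-diagonal v w i<k))
                                                             (*-congˡ (pascal-above-diagonal v w (s≤s (<⇒≤ i<k)))) ⟩
    v * 0# + w * 0#                                ≈⟨ +-cong (zeroʳ v) (zeroʳ w) ⟩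
    0# + 0#                                        ≈⟨ +-identityˡ 0# ⟩
    0#                                             ∎

  I≈pascal : ∀ n → I n ≈M trunc n (pascal 1# 0#)
  I≈pascal n = entry
    where
    p = pascal 1# 0#
    entry : ∀ {n} (i j : Fin n) → I n i j ≈ p (toℕ i) (toℕ j)
    entry Fin.zero    Fin.zero    = refl
    entry Fin.zero    (Fin.suc j) = refl
    entry (Fin.suc i) Fin.zero    = sym (zeroˡ _)
    entry (Fin.suc i) (Fin.suc j) = begin
      I _ (Fin.suc i) (Fin.suc j)                            ≡⟨ I-suc i j ⟩
      I _ i j                                                ≈⟨ entry i j ⟩
      p (toℕ i) (toℕ j)                                      ≈⟨ +-identityʳ _ ⟨
      p (toℕ i) (toℕ j) + 0#                                 ≈⟨ +-cong (*-identityˡ _) (zeroˡ _) ⟨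
      1# * p (toℕ i) (toℕ j) + 0# * p (toℕ i) (suc (toℕ j))  ≈⟨ pascal-suc-suc 1# 0# (toℕ i) (toℕ j) ⟨
      p (suc (toℕ i)) (suc (toℕ j))                          ∎

  mul : ℕ → (ℕ → ℕ → Carrier) → (ℕ → ℕ → Carrier) → ℕ → ℕ → Carrier
  mul N a m i j = ∑[ k < N ] (a i (toℕ k) * m (toℕ k) j)

  trunc-· : ∀ n a m → (trunc n a · trunc n m) ≈M trunc n (mul n a m)
  trunc-· n a m i j = reflexive (·-entry (trunc n a) (trunc n m) i j)

  mul-suc-vanishing : ∀ N a m i j → a i N ≈ 0# → mul (suc N) a m i j ≈ mul N a m i j
  mul-suc-vanishing zero    a m i j aiN≈0 = trans (+-identityʳ _) (trans (*-congʳ aiN≈0) (zeroˡ _))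
  mul-suc-vanishing (suc N) a m i j aiN≈0 =
    +-congˡ (mul-suc-vanishing N (λ i k → a i (suc k)) (m ∘ suc) i j aiN≈0)

  mul-row-recurrence : ∀ {x y z m} → (∀ k j → RecurrenceAt x y z m k j) → ∀ N a i j →
    mul N a (m ∘ suc) i (suc j) ≈
      x * mul N a (m ∘ suc) i j + y * mul N a m i j + z * mul N a m i (suc j)
  mul-row-recurrence {x} {y} {z} {m} recurrence N a i j = begin
    mul N a (m ∘ suc) i (suc j)
      ≈⟨ sum-cong-≋ {N} (λ k → trans (*-congˡ (recurrence (toℕ k) j))
                                      (distribute (a i (toℕ k)) x y z _ _ _)) ⟩
    ∑[ k < N ] (x * s k + y * u k + z * r k)
      ≈⟨ trans (∑-distrib-+ (λ k → x * s k + y * u k) (λ k → z * r k))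
               (+-congʳ (∑-distrib-+ (λ k → x * s k) (λ k → y * u k))) ⟩
    ∑[ k < N ] (x * s k) + ∑[ k < N ] (y * u k) + ∑[ k < N ] (z * r k)
      ≈⟨ +-cong (+-cong (*-distribˡ-sum x s) (*-distribˡ-sum y u)) (*-distribˡ-sum z r) ⟨
    x * mul N a (m ∘ suc) i j + y * mul N a m i j + z * mul N a m i (suc j)
      ∎
    where
    s u r : Fin N → Carrier
    s k = a i (toℕ k) * m (suc (toℕ k)) j
    u k = a i (toℕ k) * m (toℕ k) j
    r k = a i (toℕ k) * m (toℕ k) (suc j)
    distribute : ∀ t x y z s u r →
      t * (x * s + y * u + z * r) ≈ x * (t * s) + y * (t * u) + z * (t * r)
    distribute = solve 7 (λ t x y z s u r → t :* (x :* s :+ y :* u :+ z :* r) :=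
                                            x :* (t :* s) :+ y :* (t :* u) :+ z :* (t :* r)) refl

  pascal-mul-suc : ∀ v w m N i j →
    mul (suc N) (pascal v w) m (suc i) j ≈
      v * mul N (pascal v w) (m ∘ suc) i j + w * mul (suc N) (pascal v w) m i j
  pascal-mul-suc v w m N i j = begin
    mul (suc N) p m (suc i) j
      ≡⟨⟩
    w * p i 0 * m 0 j + ∑[ k < N ] (p (suc i) (suc (toℕ k)) * m (suc (toℕ k)) j)
      ≈⟨ +-congˡ (sum-cong-≋ {N} (λ k → trans (*-congʳ (pascal-suc-suc v w i (toℕ k)))
                                               (distribute v w _ _ _))) ⟩
    w * p i 0 * m 0 j + ∑[ k < N ] (v * s k + w * r k)
      ≈⟨ +-congˡ (trans (∑-distrib-+ (λ k → v * s k) (λ k → w * r k))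
                        (sym (+-cong (*-distribˡ-sum v s) (*-distribˡ-sum w r)))) ⟩
    w * p i 0 * m 0 j + (v * ∑[ k < N ] s k + w * ∑[ k < N ] r k)
      ≈⟨ regroup v w (p i 0) (m 0 j) (∑[ k < N ] s k) (∑[ k < N ] r k) ⟩
    v * ∑[ k < N ] s k + w * (p i 0 * m 0 j + ∑[ k < N ] r k)
      ∎
    where
    p = pascal v w
    s r : Fin N → Carrier
    s k = p i (toℕ k) * m (suc (toℕ k)) j
    r k = p i (suc (toℕ k)) * m (suc (toℕ k)) j
    distribute : ∀ v w e f g → (v * e + w * f) * g ≈ v * (e * g) + w * (f * g)
    distribute = solve 5 (λ v w e f g → (v :* e :+ w :* f) :* g :=
                                        v :* (e :* g) :+ w :* (f :* g)) refl
    regroup : ∀ v w e g S R → w * e * g + (v * S + w * R) ≈ v * S + w * (e * g + R)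
    regroup = solve 6 (λ v w e g S R → w :* e :* g :+ (v :* S :+ w :* R) :=
                                       v :* S :+ w :* (e :* g :+ R)) refl

  -- The semiring solver cannot cancel x * w against - (x * w), so - (x * w) enters as an
  -- atom t and the cancellation x * w + t ≈ 0# is done by hand.
  recurrence-coefficients : ∀ x y z v w s q q′ →
    v * (x * s + y * q + z * q′) + w * q′ ≈
      x * (v * s + w * q) + (v * y - x * w) * q + (w + v * z) * q′
  recurrence-coefficients x y z v w s q q′ = sym (begin
    x * (v * s + w * q) + (v * y - x * w) * q + (w + v * z) * q′
      ≈⟨ add-cancelling x y z v w s q q′ (- (x * w)) ⟩
    v * (x * s + y * q + z * q′) + w * q′ + (x * w - x * w) * q
      ≈⟨ +-congˡ (trans (*-congʳ (-‿inverseʳ (x * w))) (zeroˡ q)) ⟩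
    v * (x * s + y * q + z * q′) + w * q′ + 0#
      ≈⟨ +-identityʳ _ ⟩
    v * (x * s + y * q + z * q′) + w * q′
      ∎)
    where
    add-cancelling : ∀ x y z v w s q q′ t →
      x * (v * s + w * q) + (v * y + t) * q + (w + v * z) * q′ ≈
        v * (x * s + y * q + z * q′) + w * q′ + (x * w + t) * q
    add-cancelling = solve 9 (λ x y z v w s q q′ t →
      x :* (v :* s :+ w :* q) :+ (v :* y :+ t) :* q :+ (w :+ v :* z) :* q′ :=
      v :* (x :* s :+ y :* q :+ z :* q′) :+ w :* q′ :+ (x :* w :+ t) :* q) refl

  pascal-mul-recurrence : ∀ {x y z m} → (∀ k j → RecurrenceAt x y z m k j) → ∀ v w n →
    RecurrenceOn n x (v * y - x * w) (w + v * z) (mul n (pascal v w) m)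
  pascal-mul-recurrence {x} {y} {z} {m} recurrence v w (suc N) i j (s≤s i<N) _ = begin
    q (suc i) (suc j)
      ≈⟨ pascal-mul-suc v w m N i (suc j) ⟩
    v * S i (suc j) + w * q i (suc j)
      ≈⟨ +-congʳ (*-congˡ (mul-row-recurrence recurrence N (pascal v w) i j)) ⟩
    v * (x * S i j + y * Q i j + z * Q i (suc j)) + w * q i (suc j)
      ≈⟨ +-congʳ (*-congˡ (+-cong (+-congˡ (*-congˡ (Q≈q j))) (*-congˡ (Q≈q (suc j))))) ⟩
    v * (x * S i j + y * q i j + z * q i (suc j)) + w * q i (suc j)
      ≈⟨ recurrence-coefficients x y z v w (S i j) (q i j) (q i (suc j)) ⟩
    x * (v * S i j + w * q i j) + (v * y - x * w) * q i j + (w + v * z) * q i (suc j)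
      ≈⟨ +-congʳ (+-congʳ (*-congˡ (pascal-mul-suc v w m N i j))) ⟨
    x * q (suc i) j + (v * y - x * w) * q i j + (w + v * z) * q i (suc j)
      ∎
    where
    q Q S : ℕ → ℕ → Carrier
    q = mul (suc N) (pascal v w) m
    Q = mul N (pascal v w) m
    S = mul N (pascal v w) (m ∘ suc)
    Q≈q : ∀ j → Q i j ≈ q i j
    Q≈q j = sym (mul-suc-vanishing N (pascal v w) m i j (pascal-above-diagonal v w i<N))

  pascal-mul-geometric-column : ∀ {ρ m} → (∀ k → m (suc k) 0 ≈ ρ * m k 0) →
    ∀ v w n i → suc i < n → mul n (pascal v w) m (suc i) 0 ≈ (w + v * ρ) * mul n (pascal v w) m i 0
  pascal-mul-geometric-column {ρ} {m} geometric v w (suc N) i (s≤s i<N) = begin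
    q (suc i) 0                  ≈⟨ pascal-mul-suc v w m N i 0 ⟩
    v * S + w * q i 0            ≈⟨ +-congʳ (*-congˡ S≈ρ*q) ⟩
    v * (ρ * q i 0) + w * q i 0  ≈⟨ factor v w ρ (q i 0) ⟩
    (w + v * ρ) * q i 0          ∎
    where
    q : ℕ → ℕ → Carrier
    q = mul (suc N) (pascal v w) m
    S = mul N (pascal v w) (m ∘ suc) i 0
    t : Fin N → Carrier
    t k = pascal v w i (toℕ k) * m (toℕ k) 0
    S≈ρ*q : S ≈ ρ * q i 0
    S≈ρ*q = begin
      S                             ≈⟨ sum-cong-≋ {N} (λ k → *-congˡ (geometric (toℕ k))) ⟩
      ∑[ k < N ] (pascal v w i (toℕ k) * (ρ * m (toℕ k) 0))
                                    ≈⟨ sum-cong-≋ {N} (λ k → x∙yz≈y∙xz _ ρ _) ⟩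
      ∑[ k < N ] (ρ * t k)          ≈⟨ *-distribˡ-sum ρ t ⟨
      ρ * mul N (pascal v w) m i 0  ≈⟨ *-congˡ (mul-suc-vanishing N (pascal v w) m i 0
                                                  (pascal-above-diagonal v w i<N)) ⟨
      ρ * q i 0                     ∎
    factor : ∀ v w ρ e → v * (ρ * e) + w * e ≈ (w + v * ρ) * e
    factor = solve 4 (λ v w ρ e → v :* (ρ :* e) :+ w :* e := (w :+ v :* ρ) :* e) refl

  pascal-mul-row-zero : ∀ v w m {n} j → j < n → mul n (pascal v w) m 0 j ≈ m 0 j
  pascal-mul-row-zero v w m {suc N} j _ =
    trans (+-cong (*-identityˡ (m 0 j)) (∑-0#* N (λ k → m (suc (toℕ k)) j))) (+-identityʳ _)

  trunc-pascal-· : ∀ n v w v′ w′ →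
    (trunc n (pascal v w) · trunc n (pascal v′ w′)) ≈M trunc n (pascal (v * v′) (w + v * w′))
  trunc-pascal-· n v w v′ w′ i j = begin
    (trunc n (pascal v w) · trunc n (pascal v′ w′)) i j
      ≈⟨ trunc-· n (pascal v w) (pascal v′ w′) i j ⟩
    q (toℕ i) (toℕ j)
      ≈⟨ P-unique column row (pascal-mul-recurrence {m = pascal v′ w′} (λ _ _ → refl) v w n) i j ⟩
    pascal (v * v′ - 0# * w) (w + v * w′) (toℕ i) (toℕ j)
      ≈⟨ pascal-cong vv′-0w≈vv′ refl (toℕ i) (toℕ j) ⟩
    pascal (v * v′) (w + v * w′) (toℕ i) (toℕ j)
      ∎
    where
    q : ℕ → ℕ → Carrier
    q = mul n (pascal v w) (pascal v′ w′)
    column : ∀ i → i < n → q i 0 ≈ pow (w + v * w′) i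
    column zero    0<n   = pascal-mul-row-zero v w (pascal v′ w′) 0 0<n
    column (suc i) 1+i<n =
      trans (pascal-mul-geometric-column {m = pascal v′ w′} (λ _ → refl) v w n i 1+i<n)
            (*-congˡ (column i (<⇒≤ 1+i<n)))
    row : ∀ j → j < n → q 0 j ≈ mu j
    row j j<n = trans (pascal-mul-row-zero v w (pascal v′ w′) j j<n) (reflexive (pascal-zero v′ w′ j))
    vv′-0w≈vv′ : v * v′ - 0# * w ≈ v * v′
    vv′-0w≈vv′ = trans (+-congˡ (trans (-‿cong (zeroˡ w)) ε⁻¹≈ε)) (+-identityʳ _)

  InWRM-· : ∀ {n A M} → InF n A → InWRM n M → InWRM n (A · M)
  InWRM-· {n} (v , w , _ , A≈F) (x , y , z , α , β , _ , M≈P) =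
    InWRM-resp (≈M-trans (·-cong A≈F M≈P) (trunc-· n (pascal v w) (P α β x y z)))
               (InWRM-trunc (pascal-mul-recurrence {m = P α β x y z} (λ _ _ → refl) v w n))

module PascalGroup {c ℓ} (K : CommutativeRing c ℓ) (isField : IsField K) where
  open CommutativeRing K
  open WRM K
  open Matrices K using (≈M-refl; ≈M-trans; ·-cong)
  open Inverses K using (inverse-unique)
  open WeightedRecurrence K using (pascal; pascal-cong; I≈pascal; trunc-pascal-·)
  open import Algebra.Properties.CommutativeSemigroup *-commutativeSemigroup using (x∙yz≈y∙xz)
  open import Algebra.Properties.Ring ring using (-‿distribʳ-*)
  open import Relation.Binary.Reasoning.Setoid setoid

  1≉0 : ¬ (1# ≈ 0#)
  1≉0 1≈0 = proj₁ isField (sym 1≈0)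

  *-nonzero : ∀ {a b} → ¬ (a ≈ 0#) → ¬ (b ≈ 0#) → ¬ (a * b ≈ 0#)
  *-nonzero {a} {b} a≉0 b≉0 ab≈0 with proj₂ isField a a≉0
  ... | a⁻¹ , aa⁻¹≈1 = b≉0 (begin
    b              ≈⟨ *-identityˡ b ⟨
    1# * b         ≈⟨ *-congʳ aa⁻¹≈1 ⟨
    a * a⁻¹ * b    ≈⟨ *-assoc a a⁻¹ b ⟩
    a * (a⁻¹ * b)  ≈⟨ x∙yz≈y∙xz a a⁻¹ b ⟩
    a⁻¹ * (a * b)  ≈⟨ *-congˡ ab≈0 ⟩
    a⁻¹ * 0#       ≈⟨ zeroʳ a⁻¹ ⟩
    0#             ∎)

  pascal-·-≈I : ∀ n {v w v′ w′} → v * v′ ≈ 1# → w + v * w′ ≈ 0# →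
    (trunc n (pascal v w) · trunc n (pascal v′ w′)) ≈M I n
  pascal-·-≈I n vv′≈1 w+vw′≈0 i j =
    trans (trunc-pascal-· n _ _ _ _ i j)
          (trans (pascal-cong vv′≈1 w+vw′≈0 (toℕ i) (toℕ j)) (sym (I≈pascal n i j)))

  InF-resp : ∀ {n A B} → A ≈M B → InF n B → InF n A
  InF-resp A≈B (v , w , v≉0 , B≈F) = v , w , v≉0 , ≈M-trans A≈B B≈F

  InF-I : ∀ n → InF n (I n)
  InF-I n = 1# , 0# , 1≉0 , I≈pascal n

  InF-· : ∀ {n A B} → InF n A → InF n B → InF n (A · B)
  InF-· {n} (v , w , v≉0 , A≈F) (v′ , w′ , v′≉0 , B≈F) =
    v * v′ , w + v * w′ , *-nonzero v≉0 v′≉0 ,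
    ≈M-trans (·-cong A≈F B≈F) (trunc-pascal-· n v w v′ w′)

  InF-inverse : ∀ {n A} → InF n A → Σ (Mat n) λ B → InF n B × IsInverse A B
  InF-inverse {n} (v , w , v≉0 , A≈F) with proj₂ isField v v≉0
  ... | u , vu≈1 =
    trunc n (pascal u (- (w * u))) , (u , - (w * u) , u≉0 , ≈M-refl) ,
    ≈M-trans (·-cong A≈F ≈M-refl) (pascal-·-≈I n vu≈1 w+v*-wu≈0) ,
    ≈M-trans (·-cong ≈M-refl A≈F) (pascal-·-≈I n (trans (*-comm u v) vu≈1) -wu+uw≈0)
    where
    u≉0 : ¬ (u ≈ 0#)
    u≉0 u≈0 = 1≉0 (trans (sym vu≈1) (trans (*-congˡ u≈0) (zeroʳ v)))
    w+v*-wu≈0 : w + v * - (w * u) ≈ 0#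
    w+v*-wu≈0 = begin
      w + v * - (w * u)    ≈⟨ +-congˡ (-‿distribʳ-* v (w * u)) ⟨
      w + - (v * (w * u))  ≈⟨ +-congˡ (-‿cong (x∙yz≈y∙xz v w u)) ⟩
      w + - (w * (v * u))  ≈⟨ +-congˡ (-‿cong (trans (*-congˡ vu≈1) (*-identityʳ w))) ⟩
      w - w                ≈⟨ -‿inverseʳ w ⟩
      0#                   ∎
    -wu+uw≈0 : - (w * u) + u * w ≈ 0#
    -wu+uw≈0 = trans (+-comm _ _) (trans (+-congʳ (*-comm u w)) (-‿inverseʳ (w * u)))

  InF-inverse-closed : ∀ {n A A′} → InF n A → IsInverse A A′ → InF n A′
  InF-inverse-closed A∈F (_ , A′A≈I) with InF-inverse A∈F
  ... | B , B∈F , AB≈I , _ = InF-resp (inverse-unique A′A≈I AB≈I) B∈F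

proposition1 : ∀ {c ℓ} (K : CommutativeRing c ℓ) → IsField K →
    let open WRM K in
    ∀ (n : ℕ) → n ≥ 1 →
      -- F is a group under matrix multiplication
      ( InF n (I n)
      × (∀ A B → InF n A → InF n B → InF n (A · B))
      × (∀ A → InF n A → Σ (Mat n) λ B → InF n B × IsInverse A B) )
      -- F maps WRM(n) into itself by left multiplication
      × (∀ A M → InF n A → InWRM n M → InWRM n (A · M))
      -- M^A := A⁻¹ M is well defined on WRM(n)
      × (∀ A A' M → InF n A → IsInverse A A' → InWRM n M → InWRM n (A' · M))
      -- M^I = M
      × (∀ J M → IsInverse (I n) J → InWRM n M → (J · M) ≈M M)
      -- M^{AB} = (M^A)^B
      × (∀ A B A' B' C' M → InF n A → InF n B →
           IsInverse A A' → IsInverse B B' → IsInverse (A · B) C' →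
           InWRM n M → (C' · M) ≈M (B' · (A' · M)))
proposition1 K isField n _ =
  (InF-I n , (λ _ _ → InF-·) , (λ _ → InF-inverse)) ,
  (λ _ _ → InWRM-·) ,
  (λ _ _ _ A∈F A⁻¹ → InWRM-· (InF-inverse-closed A∈F A⁻¹)) ,
  (λ _ M I⁻¹ _ → right-action-identity I⁻¹ M) ,
  (λ _ _ _ _ _ M _ _ A⁻¹ B⁻¹ AB⁻¹ _ → right-action-compose A⁻¹ B⁻¹ AB⁻¹ M)
  where
  open PascalGroup K isField
  open Inverses K using (right-action-identity; right-action-compose)
  open WeightedRecurrence K using (InWRM-·)
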